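{- Let $n \in \mathbb{N}$ be such that $2^n-1$ is prime. Then the following system in the variables $x_1,\ldots,x_{n+8}$: \[ \begin{array}{rcl} x_i \cdot x_i &=& x_{i+1} \quad \text{for every } i \in \{1,\ldots,n\}, \\ x_{n+2} &=& 1, \\ x_{n+3}+x_{n+2} &=& x_{n+4}, \\ x_{n+4}+x_{n+2} &=& x_{n+5}, \\ x_{n+5}+x_{n+2} &=& x_1, \\ x_{n+5} \cdot x_{n+5} &=& x_{n+6}, \\ x_{n+6} \cdot x_{n+7} &=& x_{n+8}, \\ x_{n+8}+x_1 &=& x_{n+1} \end{array} \] has a unique solution $(x_1,\ldots,x_{n+8})$ in non-negative integers, and for this solution $\max(x_1,\ldots,x_{n+8}) = x_{n+1} = (2^n)^{2^n}$.
   Context: $\mathbb{N}$ denotes the set of non-negative integers. -}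

module Defs where

open import Data.Nat using (ℕ; suc; _+_; _*_; _≤_)
open import Data.Product using (_×_)
open import Relation.Binary.PropositionalEquality using (_≡_)

-- An assignment of the variables x₁,…,x_{n+8} is a function x : ℕ → ℕ,
-- where only the values at indices 1,…,n+8 are relevant.

System : ℕ → (ℕ → ℕ) → Set
System n x =
    (∀ i → 1 ≤ i → i ≤ n → x i * x i ≡ x (suc i))
  × (x (n + 2) ≡ 1)
  × (x (n + 3) + x (n + 2) ≡ x (n + 4))
  × (x (n + 4) + x (n + 2) ≡ x (n + 5))
  × (x (n + 5) + x (n + 2) ≡ x 1)
  × (x (n + 5) * x (n + 5) ≡ x (n + 6))
  × (x (n + 6) * x (n + 7) ≡ x (n + 8))
  × (x (n + 8) + x 1 ≡ x (n + 1))

-- Write b = x_{n+5}. The linear equations force x_1 = b + 1 with b ≥ 2, the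
-- squaring chain gives x_{n+1} = (b + 1)^(2^n), and the last three equations say
-- (b + 1)^(2^n) = b² x_{n+7} + (b + 1). Since (b + 1)^m ≡ 1 + m b (mod b²), this
-- forces b ∣ 2^n − 1, hence b = 2^n − 1 by primality, after which every variable is
-- determined. Conversely p = 2^n − 1 satisfies (p + 1)^(p + 1) ≡ p + 1 (mod p²),
-- which supplies x_{n+7}.
module Submission where

open import Defs
open import Data.Empty using (⊥-elim)
open import Data.Nat
open import Data.Nat.Divisibility using (_∣_; divides; ∣m+n∣m⇒∣n)
open import Data.Nat.Primality using (Prime; prime⇒irreducible; prime⇒nonTrivial)
open import Data.Nat.Properties
open import Data.Nat.Solver using (module +-*-Solver)
open import Data.Product using (Σ; _×_; _,_)
open import Data.Sum using (inj₁; inj₂)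
open import Relation.Binary.PropositionalEquality
open import Relation.Nullary using (yes; no)
open +-*-Solver
open ≡-Reasoning

binomialTail : ℕ → ℕ → ℕ
binomialTail b zero    = 0
binomialTail b (suc m) = binomialTail b m + m + b * binomialTail b m

[1+b]^m-expansion : ∀ b m → suc b ^ m ≡ 1 + m * b + b * b * binomialTail b m
[1+b]^m-expansion b zero    = cong suc (sym (*-zeroʳ (b * b)))
[1+b]^m-expansion b (suc m) = begin
  suc b * suc b ^ m                     ≡⟨ cong (suc b *_) ([1+b]^m-expansion b m) ⟩
  suc b * (1 + m * b + b * b * c)       ≡⟨ solve 3 (λ b m c →
      (con 1 :+ b) :* (con 1 :+ m :* b :+ b :* b :* c)
        := con 1 :+ (con 1 :+ m) :* b :+ b :* b :* (c :+ m :+ b :* c)) refl b m c ⟩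
  1 + suc m * b + b * b * binomialTail b (suc m) ∎
  where c = binomialTail b m

[1+p]^[1+p]≡p*p*q+[1+p] : ∀ p → suc p ^ suc p ≡ p * p * suc (binomialTail p (suc p)) + suc p
[1+p]^[1+p]≡p*p*q+[1+p] p = trans ([1+b]^m-expansion p (suc p))
  (solve 2 (λ p c → con 1 :+ (con 1 :+ p) :* p :+ p :* p :* c
                    := p :* p :* (con 1 :+ c) :+ (con 1 :+ p)) refl p (binomialTail p (suc p)))

[1+b]^[1+k]≡b*b*z+[1+b]⇒b∣k : ∀ b k z → .{{NonZero b}} →
                              suc b ^ suc k ≡ b * b * z + suc b → b ∣ k
[1+b]^[1+k]≡b*b*z+[1+b]⇒b∣k b k z eq =
  ∣m+n∣m⇒∣n (divides z (*-cancelˡ-≡ _ _ b b*[b*c+k]≡b*[z*b])) (divides c (*-comm b c))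
  where
  c = binomialTail b (suc k)
  b*[b*c+k]≡b*[z*b] : b * (b * c + k) ≡ b * (z * b)
  b*[b*c+k]≡b*[z*b] = +-cancelʳ-≡ (suc b) _ _ (begin
    b * (b * c + k) + suc b    ≡⟨ solve 3 (λ b k c → b :* (b :* c :+ k) :+ (con 1 :+ b)
                                   := con 1 :+ (con 1 :+ k) :* b :+ b :* b :* c) refl b k c ⟩
    1 + suc k * b + b * b * c  ≡⟨ sym ([1+b]^m-expansion b (suc k)) ⟩
    suc b ^ suc k              ≡⟨ eq ⟩
    b * b * z + suc b          ≡⟨ cong (_+ suc b) (*-assoc b b z) ⟩
    b * (b * z) + suc b        ≡⟨ cong (λ t → b * t + suc b) (*-comm b z) ⟩
    b * (z * b) + suc b        ∎)

a^e*a^e≡a^[2*e] : ∀ a e → a ^ e * a ^ e ≡ a ^ (2 * e)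
a^e*a^e≡a^[2*e] a e = begin
  a ^ e * a ^ e   ≡⟨ sym (^-distribˡ-+-* a e e) ⟩
  a ^ (e + e)     ≡⟨ cong (λ t → a ^ (e + t)) (sym (+-identityʳ e)) ⟩
  a ^ (2 * e)     ∎

squaring-chain : ∀ (x : ℕ → ℕ) n → (∀ i → 1 ≤ i → i ≤ n → x i * x i ≡ x (suc i)) →
                 ∀ j → j ≤ n → x (suc j) ≡ x 1 ^ 2 ^ j
squaring-chain x n sq zero    _    = sym (*-identityʳ (x 1))
squaring-chain x n sq (suc j) 1+j≤n = begin
  x (suc (suc j))                   ≡⟨ sym (sq (suc j) (s≤s z≤n) 1+j≤n) ⟩
  x (suc j) * x (suc j)             ≡⟨ cong₂ _*_ x[1+j] x[1+j] ⟩
  x 1 ^ 2 ^ j * x 1 ^ 2 ^ j         ≡⟨ a^e*a^e≡a^[2*e] (x 1) (2 ^ j) ⟩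
  x 1 ^ 2 ^ suc j                   ∎
  where x[1+j] = squaring-chain x n sq j (≤-trans (n≤1+n j) 1+j≤n)

index-cases : ∀ {ℓ} (P : ℕ → Set ℓ) n → (∀ i → 1 ≤ i → i ≤ n + 1 → P i) →
              P (n + 2) → P (n + 3) → P (n + 4) → P (n + 5) → P (n + 6) → P (n + 7) → P (n + 8) →
              ∀ i → 1 ≤ i → i ≤ n + 8 → P i
index-cases P n chain p₂ p₃ p₄ p₅ p₆ p₇ p₈ i 1≤i i≤n+8 with i ≤? n + 1
... | yes i≤n+1 = chain i 1≤i i≤n+1
... | no  i≰n+1 = subst P n+1+k≡i (offset k (m<n⇒0<n∸m n+1<i) k≤7)
  where
  n+1<i = ≰⇒> i≰n+1
  k = i ∸ (n + 1)
  n+1+k≡i : n + suc k ≡ i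
  n+1+k≡i = trans (sym (+-assoc n 1 k)) (m+[n∸m]≡n (<⇒≤ n+1<i))
  k≤7 : k ≤ 7
  k≤7 = +-cancelˡ-≤ (n + 1) k 7 (subst₂ _≤_ (sym (trans (+-assoc n 1 k) n+1+k≡i)) (sym (+-assoc n 1 7)) i≤n+8)
  offset : ∀ k → 1 ≤ k → k ≤ 7 → P (n + suc k)
  offset 1 _ _ = p₂
  offset 2 _ _ = p₃
  offset 3 _ _ = p₄
  offset 4 _ _ = p₅
  offset 5 _ _ = p₆
  offset 6 _ _ = p₇
  offset 7 _ _ = p₈
  offset (suc (suc (suc (suc (suc (suc (suc (suc _)))))))) _
         (s≤s (s≤s (s≤s (s≤s (s≤s (s≤s (s≤s ())))))))

module Solution (n : ℕ) where

  N : ℕ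
  N = 2 ^ n

  p : ℕ
  p = N ∸ 1

  q : ℕ
  q = suc (binomialTail p (suc p))

  1+p≡N : suc p ≡ N
  1+p≡N = m+[n∸m]≡n (m^n>0 2 n)

  N^N≡p*p*q+N : N ^ N ≡ p * p * q + N
  N^N≡p*p*q+N = subst (λ a → a ^ a ≡ p * p * q + a) 1+p≡N ([1+p]^[1+p]≡p*p*q+[1+p] p)

  -- The first argument is the offset i ∸ (n + 1), which is 0 exactly on the squaring
  -- chain x 1 … x (n + 1).
  valueAt : ℕ → ℕ → ℕ
  valueAt 0 i = N ^ 2 ^ (i ∸ 1)
  valueAt 1 _ = 1
  valueAt 2 _ = p ∸ 2
  valueAt 3 _ = p ∸ 1
  valueAt 4 _ = p
  valueAt 5 _ = p * p
  valueAt 6 _ = q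
  valueAt 7 _ = p * p * q
  valueAt _ _ = 0

  solution : ℕ → ℕ
  solution i = valueAt (i ∸ (n + 1)) i

  solution-chain : ∀ i → i ≤ n + 1 → solution i ≡ N ^ 2 ^ (i ∸ 1)
  solution-chain i i≤n+1 = cong (λ d → valueAt d i) (m≤n⇒m∸n≡0 i≤n+1)

  solution-offset : ∀ k → solution (n + suc k) ≡ valueAt k (n + suc k)
  solution-offset k = cong (λ d → valueAt d (n + suc k)) ([m+n]∸[m+o]≡n∸o n (suc k) 1)

  solution-1 : solution 1 ≡ N
  solution-1 = trans (solution-chain 1 (m≤n+m 1 n)) (*-identityʳ N)

  solution-[n+1] : solution (n + 1) ≡ N ^ N
  solution-[n+1] = trans (solution-chain (n + 1) ≤-refl) (cong (λ e → N ^ 2 ^ e) (m+n∸n≡m n 1))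

  module _ (2≤p : 2 ≤ p) where

    solution-squares : ∀ i → 1 ≤ i → i ≤ n → solution i * solution i ≡ solution (suc i)
    solution-squares (suc j) _ 1+j≤n = begin
      solution (suc j) * solution (suc j)  ≡⟨ cong₂ _*_ x[1+j] x[1+j] ⟩
      N ^ 2 ^ j * N ^ 2 ^ j                ≡⟨ a^e*a^e≡a^[2*e] N (2 ^ j) ⟩
      N ^ 2 ^ suc j                        ≡⟨ sym (solution-chain (2 + j) 2+j≤n+1) ⟩
      solution (2 + j)                     ∎
      where
      x[1+j] = solution-chain (suc j) (≤-trans 1+j≤n (m≤m+n n 1))
      2+j≤n+1 = subst (2 + j ≤_) (+-comm 1 n) (s≤s 1+j≤n)

    solution-satisfies : System n solution
    solution-satisfies
      = solution-squares
      , solution-offset 1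
      , trans (cong₂ _+_ (solution-offset 2) (solution-offset 1))
              (trans (+-comm (p ∸ 2) 1) (trans (sym (+-∸-assoc 1 2≤p)) (sym (solution-offset 3))))
      , trans (cong₂ _+_ (solution-offset 3) (solution-offset 1))
              (trans (m∸n+n≡m (≤-trans (n≤1+n 1) 2≤p)) (sym (solution-offset 4)))
      , trans (cong₂ _+_ (solution-offset 4) (solution-offset 1))
              (trans (+-comm p 1) (trans 1+p≡N (sym solution-1)))
      , trans (cong₂ _*_ (solution-offset 4) (solution-offset 4)) (sym (solution-offset 5))
      , trans (cong₂ _*_ (solution-offset 5) (solution-offset 6)) (sym (solution-offset 7))
      , trans (cong₂ _+_ (solution-offset 7) solution-1)
              (trans (sym N^N≡p*p*q+N) (sym solution-[n+1]))

    private instance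
      N≢0 : NonZero N
      N≢0 = m^n≢0 2 n
      p≢0 : NonZero p
      p≢0 = >-nonZero (≤-trans (n≤1+n 1) 2≤p)
      p*p≢0 : NonZero (p * p)
      p*p≢0 = m*n≢0 p p

    solution-maximal : ∀ i → 1 ≤ i → i ≤ n + 8 → solution i ≤ solution (n + 1)
    solution-maximal = index-cases (λ i → solution i ≤ solution (n + 1)) n on-chain
      (at-offset 1 (≤-trans (m^n>0 2 n) N≤T))
      (at-offset 2 (≤-trans (m∸n≤m p 2) p≤T))
      (at-offset 3 (≤-trans (m∸n≤m p 1) p≤T))
      (at-offset 4 p≤T)
      (at-offset 5 (≤-trans (m≤m*n (p * p) q) p*p*q≤T))
      (at-offset 6 (≤-trans (m≤n*m q (p * p)) p*p*q≤T))
      (at-offset 7 p*p*q≤T)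
      where
      T = p * p * q + N
      N≤T = m≤n+m N (p * p * q)
      p≤T = ≤-trans (subst (p ≤_) 1+p≡N (n≤1+n p)) N≤T
      p*p*q≤T = m≤m+n (p * p * q) N

      at-offset : ∀ k → valueAt k (n + suc k) ≤ T → solution (n + suc k) ≤ solution (n + 1)
      at-offset k = subst₂ _≤_ (sym (solution-offset k)) (sym (trans solution-[n+1] N^N≡p*p*q+N))

      on-chain : ∀ i → 1 ≤ i → i ≤ n + 1 → solution i ≤ solution (n + 1)
      on-chain i _ i≤n+1 = subst₂ _≤_ (sym (solution-chain i i≤n+1)) (sym solution-[n+1])
        (^-monoʳ-≤ N (^-monoʳ-≤ 2 (m≤n+o⇒m∸n≤o i 1 (subst (i ≤_) (+-comm n 1) i≤n+1))))

module _ (n : ℕ) (p-prime : Prime (2 ^ n ∸ 1)) where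
  open Solution n

  2≤p : 2 ≤ p
  2≤p = nonTrivial⇒n>1 p {{prime⇒nonTrivial p-prime}}

  solution-unique : ∀ y → System n y → ∀ i → 1 ≤ i → i ≤ n + 8 → y i ≡ solution i
  solution-unique y (squares , x₂ , e₃ , e₄ , e₅ , e₆ , e₇ , e₈) =
    index-cases (λ i → y i ≡ solution i) n on-chain
      (at-offset 1 x₂)
      (at-offset 2 y[n+3]≡p∸2)
      (at-offset 3 y[n+4]≡p∸1)
      (at-offset 4 b≡p)
      (at-offset 5 y[n+6]≡p*p)
      (at-offset 6 y[n+7]≡q)
      (at-offset 7 (trans (sym e₇) (cong₂ _*_ y[n+6]≡p*p y[n+7]≡q)))
    where
    b = y (n + 5)

    pred-of : ∀ {a c} → a + 1 ≡ c → a ≡ c ∸ 1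
    pred-of {a} a+1≡c = trans (sym (m+n∸n≡m a 1)) (cong (_∸ 1) a+1≡c)

    y[n+3]+1≡y[n+4] : y (n + 3) + 1 ≡ y (n + 4)
    y[n+3]+1≡y[n+4] = subst (λ t → y (n + 3) + t ≡ y (n + 4)) x₂ e₃

    y[n+4]+1≡b : y (n + 4) + 1 ≡ b
    y[n+4]+1≡b = subst (λ t → y (n + 4) + t ≡ b) x₂ e₄

    y1≡1+b : y 1 ≡ suc b
    y1≡1+b = trans (sym (subst (λ t → b + t ≡ y 1) x₂ e₅)) (+-comm b 1)

    2≤b : 2 ≤ b
    2≤b = subst (2 ≤_) (trans (cong (_+ 1) y[n+3]+1≡y[n+4]) y[n+4]+1≡b)
                (subst (2 ≤_) (sym (+-assoc (y (n + 3)) 1 1)) (m≤n+m 2 (y (n + 3))))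

    instance
      b≢0 : NonZero b
      b≢0 = >-nonZero (≤-trans (n≤1+n 1) 2≤b)
      p≢0 : NonZero p
      p≢0 = >-nonZero (≤-trans (n≤1+n 1) 2≤p)
      p*p≢0 : NonZero (p * p)
      p*p≢0 = m*n≢0 p p

    [1+b]^N≡b*b*y[n+7]+[1+b] : suc b ^ N ≡ b * b * y (n + 7) + suc b
    [1+b]^N≡b*b*y[n+7]+[1+b] = begin
      suc b ^ N                      ≡⟨ cong (_^ N) (sym y1≡1+b) ⟩
      y 1 ^ 2 ^ n                    ≡⟨ sym (squaring-chain y n squares n ≤-refl) ⟩
      y (suc n)                      ≡⟨ cong y (+-comm 1 n) ⟩
      y (n + 1)                      ≡⟨ sym e₈ ⟩
      y (n + 8) + y 1                ≡⟨ cong₂ _+_ (sym e₇) y1≡1+b ⟩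
      y (n + 6) * y (n + 7) + suc b  ≡⟨ cong (λ t → t * y (n + 7) + suc b) (sym e₆) ⟩
      b * b * y (n + 7) + suc b      ∎

    b≡p : b ≡ p
    b≡p with prime⇒irreducible p-prime ([1+b]^[1+k]≡b*b*z+[1+b]⇒b∣k b p (y (n + 7))
               (subst (λ m → suc b ^ m ≡ b * b * y (n + 7) + suc b) (sym 1+p≡N) [1+b]^N≡b*b*y[n+7]+[1+b]))
    ... | inj₁ b≡1 = ⊥-elim (<⇒≢ 2≤b (sym b≡1))
    ... | inj₂ b≡p = b≡p

    y[n+4]≡p∸1 : y (n + 4) ≡ p ∸ 1
    y[n+4]≡p∸1 = trans (pred-of y[n+4]+1≡b) (cong (_∸ 1) b≡p)

    y[n+3]≡p∸2 : y (n + 3) ≡ p ∸ 2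
    y[n+3]≡p∸2 = trans (pred-of y[n+3]+1≡y[n+4]) (trans (cong (_∸ 1) y[n+4]≡p∸1) (∸-+-assoc p 1 1))

    y[n+6]≡p*p : y (n + 6) ≡ p * p
    y[n+6]≡p*p = trans (sym e₆) (cong₂ _*_ b≡p b≡p)

    y[n+7]≡q : y (n + 7) ≡ q
    y[n+7]≡q = *-cancelˡ-≡ _ _ (p * p) (+-cancelʳ-≡ (suc p) _ _ (begin
      p * p * y (n + 7) + suc p  ≡⟨ sym (subst (λ c → suc c ^ N ≡ c * c * y (n + 7) + suc c) b≡p
                                                [1+b]^N≡b*b*y[n+7]+[1+b]) ⟩
      suc p ^ N                  ≡⟨ cong (_^ N) 1+p≡N ⟩
      N ^ N                      ≡⟨ N^N≡p*p*q+N ⟩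
      p * p * q + N              ≡⟨ cong (p * p * q +_) (sym 1+p≡N) ⟩
      p * p * q + suc p          ∎))

    at-offset : ∀ k → y (n + suc k) ≡ valueAt k (n + suc k) → y (n + suc k) ≡ solution (n + suc k)
    at-offset k eq = trans eq (sym (solution-offset k))

    on-chain : ∀ i → 1 ≤ i → i ≤ n + 1 → y i ≡ solution i
    on-chain (suc j) _ 1+j≤n+1 = begin
      y (suc j)         ≡⟨ squaring-chain y n squares j (≤-pred (subst (suc j ≤_) (+-comm n 1) 1+j≤n+1)) ⟩
      y 1 ^ 2 ^ j       ≡⟨ cong (_^ 2 ^ j) (trans y1≡1+b (trans (cong suc b≡p) 1+p≡N)) ⟩
      N ^ 2 ^ j         ≡⟨ sym (solution-chain (suc j) 1+j≤n+1) ⟩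
      solution (suc j)  ∎

theorem2 : (n : ℕ) → Prime (2 ^ n ∸ 1) →
    Σ (ℕ → ℕ) (λ x →
        System n x
      × (∀ (y : ℕ → ℕ) → System n y → ∀ i → 1 ≤ i → i ≤ n + 8 → y i ≡ x i)
      × (∀ i → 1 ≤ i → i ≤ n + 8 → x i ≤ x (n + 1))
      × (x (n + 1) ≡ (2 ^ n) ^ (2 ^ n)))
theorem2 n p-prime =
    solution
  , solution-satisfies (2≤p n p-prime)
  , solution-unique n p-prime
  , solution-maximal (2≤p n p-prime)
  , solution-[n+1]
  where open Solution n
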